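{- Let $i$ be an agent. If $\vdash\neg U_i\phi$ for every formula $\phi$ of $\mathbf{LUT}$, then $\vdash\neg\bullet_i\phi$ for every formula $\phi$ of $\mathbf{LUT}$.
   Context: Let $\mathbf{P}$ be a countably infinite set of propositional variables and $\mathbf{I}$ a finite set of agents. The language $\mathbf{LUT}$ is given by $\phi::= p\mid\neg\phi\mid(\phi\land\phi)\mid K_i\phi\mid[\phi]\phi\mid U_i\phi$ ($p\in\mathbf{P}$, $i\in\mathbf{I}$); $\mathbf{EL}$ is the fragment without $[\cdot]$ and $U_i$. The abbreviation $\bullet_i\phi$ stands for $\phi\land\neg K_i\phi$. Admissible forms: $\eta(\sharp)::=\sharp\mid\phi\to\eta(\sharp)\mid K_i\eta(\sharp)\mid[\phi]\eta(\sharp)$; $\eta(\chi)$ denotes the result of replacing $\sharp$ by $\chi$. $\vdash\phi$ means $\phi$ is a theorem of the proof system $\mathbb{LUT}$, whose axioms are: propositional tautologies; $K_i(\phi\to\psi)\to(K_i\phi\to K_i\psi)$; $[\chi](\phi\to\psi)\to([\chi]\phi\to[\chi]\psi)$; $K_i\phi\to\phi$; $[\psi]p\leftrightarrow(\psi\to p)$; $[\psi]\neg\phi\leftrightarrow(\psi\to\neg[\psi]\phi)$; $[\psi](\phi\land\chi)\leftrightarrow([\psi]\phi\land[\psi]\chi)$; $[\psi]K_i\phi\leftrightarrow(\psi\to K_i[\psi]\phi)$; $[\psi][\chi]\phi\leftrightarrow[\psi\land[\psi]\chi]\phi$; $U_i\phi\to\phi\land[\psi]\neg K_i\phi$ for each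 $\psi\in\mathbf{EL}$; and whose rules are modus ponens, $\phi/K_i\phi$, $\phi/[\chi]\phi$, and RU: from $\eta(\phi\land[\psi]\neg K_i\phi)$ for all $\psi\in\mathbf{EL}$ infer $\eta(U_i\phi)$, for any admissible form $\eta$. -}

module Defs where

open import Data.Nat using (ℕ)
open import Data.Fin using (Fin)
open import Data.Bool using (Bool; true; false; not; _∧_)
open import Relation.Binary.PropositionalEquality using (_≡_)

data Formula (n : ℕ) : Set where
  var  : ℕ → Formula n
  ¬′_  : Formula n → Formula n
  _∧′_ : Formula n → Formula n → Formula n
  K    : Fin n → Formula n → Formula n
  [_]_ : Formula n → Formula n → Formula n
  U    : Fin n → Formula n → Formula n

infixr 30 _∧′_
infix 40 ¬′_
infixr 40 [_]_

module _ {n : ℕ} where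

  infixr 20 _⇒_
  infix 15 _⇔_
  _⇒_ : Formula n → Formula n → Formula n
  φ ⇒ ψ = ¬′ (φ ∧′ ¬′ ψ)

  _⇔_ : Formula n → Formula n → Formula n
  φ ⇔ ψ = (φ ⇒ ψ) ∧′ (ψ ⇒ φ)

  • : Fin n → Formula n → Formula n
  • i φ = φ ∧′ ¬′ K i φ

  data IsEL : Formula n → Set where
    var : ∀ p → IsEL (var p)
    neg : ∀ {φ} → IsEL φ → IsEL (¬′ φ)
    and : ∀ {φ ψ} → IsEL φ → IsEL ψ → IsEL (φ ∧′ ψ)
    kn  : ∀ {i φ} → IsEL φ → IsEL (K i φ)

  -- Propositional tautologies: formulas true under every Boolean valuation
  -- that treats every non-Boolean subformula (variables, K_i, [.], U_i) as an atom.
  eval : (Formula n → Bool) → Formula n → Bool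
  eval v (¬′ φ)    = not (eval v φ)
  eval v (φ ∧′ ψ)  = eval v φ ∧ eval v ψ
  eval v φ         = v φ

  Tautology : Formula n → Set
  Tautology φ = ∀ (v : Formula n → Bool) → eval v φ ≡ true

  data AdmForm : Set where
    ♯    : AdmForm
    imp  : Formula n → AdmForm → AdmForm
    Kf   : Fin n → AdmForm → AdmForm
    annf : Formula n → AdmForm → AdmForm

  plug : AdmForm → Formula n → Formula n
  plug ♯          χ = χ
  plug (imp φ η)  χ = φ ⇒ plug η χ
  plug (Kf i η)   χ = K i (plug η χ)
  plug (annf φ η) χ = [ φ ] plug η χ

  data ⊢_ : Formula n → Set where
    taut  : ∀ {φ} → Tautology φ → ⊢ φ
    axK   : ∀ {i φ ψ} → ⊢ (K i (φ ⇒ ψ) ⇒ (K i φ ⇒ K i ψ))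
    axAK  : ∀ {χ φ ψ} → ⊢ ([ χ ] (φ ⇒ ψ) ⇒ ([ χ ] φ ⇒ [ χ ] ψ))
    axT   : ∀ {i φ} → ⊢ (K i φ ⇒ φ)
    axAp  : ∀ {ψ p} → ⊢ (([ ψ ] var p) ⇔ (ψ ⇒ var p))
    axAn  : ∀ {ψ φ} → ⊢ (([ ψ ] ¬′ φ) ⇔ (ψ ⇒ ¬′ ([ ψ ] φ)))
    axAc  : ∀ {ψ φ χ} → ⊢ (([ ψ ] (φ ∧′ χ)) ⇔ (([ ψ ] φ) ∧′ ([ ψ ] χ)))
    axAK′ : ∀ {ψ i φ} → ⊢ (([ ψ ] K i φ) ⇔ (ψ ⇒ K i ([ ψ ] φ)))
    axAA  : ∀ {ψ χ φ} → ⊢ (([ ψ ] [ χ ] φ) ⇔ ([ ψ ∧′ ([ ψ ] χ) ] φ))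
    axU   : ∀ {i φ ψ} → IsEL ψ → ⊢ (U i φ ⇒ (φ ∧′ ([ ψ ] ¬′ K i φ)))
    mp    : ∀ {φ ψ} → ⊢ (φ ⇒ ψ) → ⊢ φ → ⊢ ψ
    necK  : ∀ {i φ} → ⊢ φ → ⊢ K i φ
    necA  : ∀ {χ φ} → ⊢ φ → ⊢ [ χ ] φ
    RU    : ∀ {i φ} (η : AdmForm) →
            (∀ (ψ : Formula n) → IsEL ψ → ⊢ plug η (φ ∧′ ([ ψ ] ¬′ K i φ))) →
            ⊢ plug η (U i φ)

  infix 5 ⊢_

{-# OPTIONS --safe #-}
module Submission where

open import Defs
open import Data.Nat using (ℕ)
open import Data.Fin using (Fin)
open import Data.Bool using (true; false; not; _∧_)
open import Relation.Binary.PropositionalEquality using (_≡_; refl)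

-- The Moore sentence •ᵢφ = φ ∧ ¬Kᵢφ can never be known: Kᵢ•ᵢφ would give both Kᵢφ and,
-- by truth, ¬Kᵢφ.  Hence [ψ]¬Kᵢ•ᵢφ is a theorem for every ψ, and the rule RU applied under
-- the admissible form •ᵢφ → ♯ yields ⊢ •ᵢφ → Uᵢ•ᵢφ.  Refuting Uᵢ•ᵢφ therefore refutes •ᵢφ.

module _ {n : ℕ} where

  ∧-elimˡ : (a b : Formula n) → ⊢ a ∧′ b ⇒ a
  ∧-elimˡ a b = taut λ v → lemma (eval v a) (eval v b)
    where
    lemma : ∀ x y → not ((x ∧ y) ∧ not x) ≡ true
    lemma false _     = refl
    lemma true  false = refl
    lemma true  true  = refl

  ∧-elimʳ : (a b : Formula n) → ⊢ a ∧′ b ⇒ b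
  ∧-elimʳ a b = taut λ v → lemma (eval v a) (eval v b)
    where
    lemma : ∀ x y → not ((x ∧ y) ∧ not y) ≡ true
    lemma false _     = refl
    lemma true  false = refl
    lemma true  true  = refl

  ⇒-∧-introʳ : {a b : Formula n} → ⊢ b → ⊢ a ⇒ a ∧′ b
  ⇒-∧-introʳ {a} {b} ⊢b = mp (taut λ v → lemma (eval v a) (eval v b)) ⊢b
    where
    lemma : ∀ x y → not (y ∧ not (not (x ∧ not (x ∧ y)))) ≡ true
    lemma _     false = refl
    lemma false true  = refl
    lemma true  true  = refl

  contrapose : {a b : Formula n} → ⊢ a ⇒ b → ⊢ ¬′ b → ⊢ ¬′ a
  contrapose {a} {b} ⊢a⇒b ⊢¬b = mp (mp (taut λ v → lemma (eval v a) (eval v b)) ⊢a⇒b) ⊢¬b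
    where
    lemma : ∀ x y → not (not (x ∧ not y) ∧ not (not (not y ∧ not (not x)))) ≡ true
    lemma false false = refl
    lemma false true  = refl
    lemma true  false = refl
    lemma true  true  = refl

  refute-by-clash : {a b c : Formula n} → ⊢ c ⇒ a → ⊢ c ⇒ b → ⊢ b ⇒ ¬′ a → ⊢ ¬′ c
  refute-by-clash {a} {b} {c} ⊢c⇒a ⊢c⇒b ⊢b⇒¬a =
    mp (mp (mp (taut λ v → lemma (eval v a) (eval v b) (eval v c)) ⊢c⇒a) ⊢c⇒b) ⊢b⇒¬a
    where
    lemma : ∀ x y z →
      not (not (z ∧ not x) ∧ not (not (not (z ∧ not y) ∧
        not (not (not (y ∧ not (not x)) ∧ not (not z)))))) ≡ true
    lemma false false false = refl
    lemma false false true  = refl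
    lemma false true  false = refl
    lemma false true  true  = refl
    lemma true  false false = refl
    lemma true  false true  = refl
    lemma true  true  false = refl
    lemma true  true  true  = refl

  K-mono : {i : Fin n} {a b : Formula n} → ⊢ a ⇒ b → ⊢ K i a ⇒ K i b
  K-mono ⊢a⇒b = mp axK (necK ⊢a⇒b)

  ¬K• : (i : Fin n) (φ : Formula n) → ⊢ ¬′ K i (• i φ)
  ¬K• i φ = refute-by-clash (K-mono (∧-elimˡ φ (¬′ K i φ))) (K-mono (∧-elimʳ φ (¬′ K i φ))) axT

  •⇒U• : (i : Fin n) (φ : Formula n) → ⊢ • i φ ⇒ U i (• i φ)
  •⇒U• i φ = RU (imp (• i φ) ♯) λ _ _ → ⇒-∧-introʳ (necA (¬K• i φ))

mainTheorem16 : (n : ℕ) (i : Fin n) →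
    ((φ : Formula n) → ⊢ ¬′ U i φ) →
    (φ : Formula n) → ⊢ ¬′ • i φ
mainTheorem16 n i ⊢¬U φ = contrapose (•⇒U• i φ) (⊢¬U (• i φ))
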